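{- Let $G$ be any graph on $n$ vertices with exactly $h$ universal vertices ($h \ge 0$). Let $k$ be an integer with $k \in [n/2, n]$. If there exists a positive integer $\alpha$ such that $$d_k(G) > \frac{1}{2k + 1 - n} \cdot \left(n^2 \cdot \binom{n - \alpha - 1}{k} + \alpha \cdot \binom{n - h}{k}\right),$$ then the sequence $d_k(G), d_{k+1}(G), \ldots, d_n(G)$ is decreasing, so the mode of the domination polynomial of $G$ is at most $k$.
   Context: All graphs are finite, undirected and simple. For a graph $G=(V,E)$ on $n$ vertices and $S \subseteq V$, the (closed) neighborhood $N(S)$ is the set of vertices that are either in $S$ or adjacent to a vertex of $S$. A set $S$ is dominating if $N(S)=V$. Let $d_i(G)$ be the number of $i$-element dominating vertex sets of $G$ (with $d_{n+1}(G)=0$); the domination polynomial is $D(G,x)=\sum_{i=1}^n d_i(G)x^i$. A vertex $v$ is universal if it is adjacent to every other vertex. Binomial coefficients $\binom{m}{k}$ are $0$ when $k>m$ (and when $m<0$). A polynomial $f(x)=\sum_{i=0}^n a_i x^i$ is unimodal if there is $k\in[0,n]$ with $a_i \le a_{i+1}$ for all $i<k$ and $a_i \ge a_{i+1}$ for all $i \ge k$; the largest such $k$ is called the mode of $f$. -}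

module Defs where

open import Data.Nat using (ℕ; zero; suc; _+_; _*_; _∸_; _≤_; _<_; _<?_)
open import Data.Nat.Combinatorics using (_C_)
open import Data.Bool using (Bool; true; false)
open import Data.Fin using (Fin)
open import Data.Fin.Subset using (Subset; _∈_; ∣_∣)
open import Data.Fin.Subset.Properties using (_∈?_)
open import Data.Fin.Properties using (all?; any?; _≟_)
open import Data.Vec using (Vec; []; _∷_)
open import Data.List using (List; []; _∷_; map; _++_; filter; length)
open import Data.Product using (_×_; ∃; _,_)
open import Data.Sum using (_⊎_)
open import Relation.Binary.PropositionalEquality using (_≡_)
open import Relation.Nullary using (Dec; yes; no; ¬_)
open import Relation.Nullary.Decidable using (_×-dec_; _⊎-dec_; ¬?)
open import Data.Bool.Properties using () renaming (_≟_ to _≟ᵇ_)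
import Data.Nat.Properties as NP

record Graph (n : ℕ) : Set where
  field
    adj   : Fin n → Fin n → Bool
    sym   : ∀ u v → adj u v ≡ adj v u
    irrefl : ∀ v → adj v v ≡ false

open Graph public

Adj : ∀ {n} → Graph n → Fin n → Fin n → Set
Adj G u v = adj G u v ≡ true

Dominating : ∀ {n} → Graph n → Subset n → Set
Dominating G S = ∀ v → v ∈ S ⊎ ∃ λ u → u ∈ S × Adj G u v

dominating? : ∀ {n} (G : Graph n) (S : Subset n) → Dec (Dominating G S)
dominating? G S = all? λ v → (v ∈? S) ⊎-dec any? (λ u → (u ∈? S) ×-dec (adj G u v ≟ᵇ true))

allSubsets : (n : ℕ) → List (Subset n)
allSubsets zero = [] ∷ []
allSubsets (suc n) = map (true ∷_) (allSubsets n) ++ map (false ∷_) (allSubsets n)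

d : ∀ {n} → Graph n → ℕ → ℕ
d {n} G i = length (filter (λ S → (∣ S ∣ NP.≟ i) ×-dec dominating? G S) (allSubsets n))

Universal : ∀ {n} → Graph n → Fin n → Set
Universal G v = ∀ u → ¬ (u ≡ v) → Adj G v u

universal? : ∀ {n} (G : Graph n) (v : Fin n) → Dec (Universal G v)
universal? G v = all? λ u → (¬? (u ≟ v)) →-dec' (adj G v u ≟ᵇ true)
  where
  open import Relation.Nullary.Decidable using () renaming (_→-dec_ to _→-dec'_)

numUniversal : ∀ {n} → Graph n → ℕ
numUniversal {n} G = length (filter (universal? G) (Data.List.allFin n))
  where import Data.List

-- binomial coefficient C(a - b, k) with the convention that it is 0 when a - b < 0
Cdiff : ℕ → ℕ → ℕ → ℕ
Cdiff a b k with a NP.<? b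
... | yes _ = 0
... | no _  = (a ∸ b) C k

{-# OPTIONS --safe #-}
module Submission where

-- Let e(T) be the number of vertices v ∉ T for which T ∪ {v} is dominating, and N_i the sum
-- of e(T) over the non-dominating i-sets T. Counting pairs (S, v) with v ∈ S and S an
-- (i+1)-element dominating set by T = S − v gives (i+1) d_{i+1} = (n−i) d_i + N_i, because a
-- dominating T has e(T) = n − i. A non-dominating T leaves some w undominated; then T avoids
-- N[w] and every universal vertex, and all extensions of T lie in N[w]. Bounding e(T) by
-- |N[w]| ≤ α, or else by n and summing over the n candidates for w, gives
-- N_i ≤ X_i := n²·C(n−α−1, i) + α·C(n−h, i).
-- Since C(m, i+1)/C(m, i) = (m−i)/(i+1) ≤ d_{i+1}/d_i for m ≤ n, the ratio X_i/d_i does not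
-- increase for i ≥ k, so the hypothesis X_k < (2k+1−n) d_k gives N_i < (2i+1−n) d_i, which by
-- the recurrence says d_{i+1} < d_i.

open import Data.Bool using (Bool; true; false; _∧_; not)
import Data.Bool.Properties as Boolₚ
open import Data.Empty using (⊥; ⊥-elim)
open import Data.Fin using (Fin; zero; suc)
import Data.Fin.Properties as Finₚ
open import Data.Fin.Subset using (Subset; ∣_∣; _∈_; _⊆_; ∁)
open import Data.Fin.Subset.Properties using (∣p∣≤n; ∣∁p∣≡n∸∣p∣; _∈?_)
open import Data.List using (List; []; _∷_; map; _++_; filter; length)
import Data.List as List
import Data.List.Properties as Listₚ
open import Data.Nat using (ℕ; zero; suc; _+_; _*_; _∸_; _≤_; _<_; z≤n; s≤s; _≡ᵇ_; _<?_; _≤?_; >-nonZero)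
open import Data.Nat.Combinatorics using (_C_; nCk+nC[k+1]≡[n+1]C[k+1]; nC1≡n; k>n⇒nCk≡0)
open import Data.Nat.Properties
open import Data.Nat.Tactic.RingSolver using (solve-∀)
open import Data.Product using (_×_; _,_; ∃)
open import Data.Sum using (_⊎_; inj₁; inj₂)
open import Data.Vec using ([]; _∷_; lookup; tabulate; here; there; _[_]≔_)
open import Data.Vec.Properties
  using (lookup-map; lookup∘tabulate; lookup∘updateAt′; []=⇒lookup; lookup⇒[]=; []≔-updates; []≔-minimal)
open import Defs hiding (sym)
open import Function using (_∘_; case_of_)
open import Relation.Binary.PropositionalEquality
open import Relation.Nullary using (Dec; yes; no; does; ¬_)
open import Relation.Nullary.Decidable using (dec-true; dec-false; _⊎-dec_; _×-dec_)
open import Relation.Unary using (Pred; Decidable)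

open import Algebra.Properties.CommutativeSemigroup +-commutativeSemigroup using (interchange; xy∙z≈y∙xz)
open import Algebra.Properties.Semiring.Sum +-*-semiring using (sum; sum-syntax; sum-cong-≗; *-distribˡ-sum)
import Algebra.Properties.CommutativeSemigroup *-commutativeSemigroup as *-Props

𝟙 : Bool → ℕ
𝟙 true  = 1
𝟙 false = 0

𝟙-≤-1 : ∀ b → 𝟙 b ≤ 1
𝟙-≤-1 true  = ≤-refl
𝟙-≤-1 false = z≤n

𝟙-∧ : ∀ a b → 𝟙 (a ∧ b) ≡ 𝟙 a * 𝟙 b
𝟙-∧ true  b = sym (+-identityʳ (𝟙 b))
𝟙-∧ false b = refl

does≡true⇒ : ∀ {p} {P : Set p} (P? : Dec P) → does P? ≡ true → P
does≡true⇒ (yes p) _ = p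

-- does (m ≟ j) reduces to m ≡ᵇ j, which is how d tests sizes.
𝟙-≡ᵇ-subst : ∀ m j (f : ℕ → ℕ) → 𝟙 (m ≡ᵇ j) * f m ≡ 𝟙 (m ≡ᵇ j) * f j
𝟙-≡ᵇ-subst m j f with m ≡ᵇ j in m≡ᵇj
... | true  = cong (λ k → 1 * f k) (does≡true⇒ (m ≟ j) m≡ᵇj)
... | false = refl

𝟙-≡ᵇ-weight : ∀ m j x → j * (𝟙 (m ≡ᵇ j) * x) ≡ m * (𝟙 (m ≡ᵇ j) * x)
𝟙-≡ᵇ-weight m j x with m ≡ᵇ j in m≡ᵇj
... | true  = cong (_* (1 * x)) (sym (does≡true⇒ (m ≟ j) m≡ᵇj))
... | false = trans (*-zeroʳ j) (sym (*-zeroʳ m))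

∑-mono-≤ : ∀ {n} {f g : Fin n → ℕ} → (∀ v → f v ≤ g v) → sum f ≤ sum g
∑-mono-≤ {zero}  f≤g = z≤n
∑-mono-≤ {suc n} f≤g = +-mono-≤ (f≤g zero) (∑-mono-≤ (f≤g ∘ suc))

∑-≤-* : ∀ {n} (f : Fin n → ℕ) {c} → (∀ v → f v ≤ c) → sum f ≤ n * c
∑-≤-* {zero}  f f≤c = z≤n
∑-≤-* {suc n} f f≤c = +-mono-≤ (f≤c zero) (∑-≤-* (f ∘ suc) (f≤c ∘ suc))

≤-∑ : ∀ {n} (f : Fin n → ℕ) v → f v ≤ sum f
≤-∑ f zero    = m≤m+n _ _
≤-∑ f (suc v) = ≤-trans (≤-∑ (f ∘ suc) v) (m≤n+m _ _)

∑-𝟙-lookup : ∀ {n} (S : Subset n) → ∑[ v < n ] 𝟙 (lookup S v) ≡ ∣ S ∣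
∑-𝟙-lookup []          = refl
∑-𝟙-lookup (true  ∷ S) = cong suc (∑-𝟙-lookup S)
∑-𝟙-lookup (false ∷ S) = ∑-𝟙-lookup S

∑ˢ : (n : ℕ) → (Subset n → ℕ) → ℕ
∑ˢ zero    f = f []
∑ˢ (suc n) f = ∑ˢ n (λ S → f (true ∷ S)) + ∑ˢ n (λ S → f (false ∷ S))

∑ˢ-cong : ∀ n {f g : Subset n → ℕ} → (∀ S → f S ≡ g S) → ∑ˢ n f ≡ ∑ˢ n g
∑ˢ-cong zero    f≗g = f≗g []
∑ˢ-cong (suc n) f≗g = cong₂ _+_ (∑ˢ-cong n (f≗g ∘ (true ∷_))) (∑ˢ-cong n (f≗g ∘ (false ∷_)))

∑ˢ-mono-≤ : ∀ n {f g : Subset n → ℕ} → (∀ S → f S ≤ g S) → ∑ˢ n f ≤ ∑ˢ n g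
∑ˢ-mono-≤ zero    f≤g = f≤g []
∑ˢ-mono-≤ (suc n) f≤g = +-mono-≤ (∑ˢ-mono-≤ n (f≤g ∘ (true ∷_))) (∑ˢ-mono-≤ n (f≤g ∘ (false ∷_)))

∑ˢ-zero : ∀ n {f : Subset n → ℕ} → (∀ S → f S ≡ 0) → ∑ˢ n f ≡ 0
∑ˢ-zero zero    f≗0 = f≗0 []
∑ˢ-zero (suc n) f≗0 = cong₂ _+_ (∑ˢ-zero n (f≗0 ∘ (true ∷_))) (∑ˢ-zero n (f≗0 ∘ (false ∷_)))

∑ˢ-distrib-+ : ∀ n (f g : Subset n → ℕ) → ∑ˢ n (λ S → f S + g S) ≡ ∑ˢ n f + ∑ˢ n g
∑ˢ-distrib-+ zero    f g = refl
∑ˢ-distrib-+ (suc n) f g = trans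
  (cong₂ _+_ (∑ˢ-distrib-+ n _ _) (∑ˢ-distrib-+ n _ _))
  (interchange (∑ˢ n (λ S → f (true ∷ S))) _ _ _)

*-distribˡ-∑ˢ : ∀ n c (f : Subset n → ℕ) → c * ∑ˢ n f ≡ ∑ˢ n (λ S → c * f S)
*-distribˡ-∑ˢ zero    c f = refl
*-distribˡ-∑ˢ (suc n) c f = trans (*-distribˡ-+ c _ _) (cong₂ _+_ (*-distribˡ-∑ˢ n c _) (*-distribˡ-∑ˢ n c _))

∑ˢ-∑-comm : ∀ n m (f : Subset n → Fin m → ℕ) →
            ∑ˢ n (λ S → ∑[ v < m ] f S v) ≡ ∑[ v < m ] ∑ˢ n (λ S → f S v)
∑ˢ-∑-comm n zero    f = ∑ˢ-zero n (λ _ → refl)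
∑ˢ-∑-comm n (suc m) f =
  trans (∑ˢ-distrib-+ n _ _) (cong (∑ˢ n (λ S → f S zero) +_) (∑ˢ-∑-comm n m (λ S v → f S (suc v))))

module _ {a p} {A : Set a} {P : Pred A p} (P? : Decidable P) where

  length-filter-∷ : ∀ x xs → length (filter P? (x ∷ xs)) ≡ 𝟙 (does (P? x)) + length (filter P? xs)
  length-filter-∷ x xs with does (P? x)
  ... | true  = refl
  ... | false = refl

  length-filter-++ : ∀ xs ys → length (filter P? (xs ++ ys)) ≡ length (filter P? xs) + length (filter P? ys)
  length-filter-++ xs ys = trans (cong length (Listₚ.filter-++ P? xs ys)) (Listₚ.length-++ (filter P? xs))

length-filter-map : ∀ {a b p} {A : Set a} {B : Set b} {P : Pred B p} (P? : Decidable P) (f : A → B) xs →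
                    length (filter P? (map f xs)) ≡ length (filter (P? ∘ f) xs)
length-filter-map P? f []       = refl
length-filter-map P? f (x ∷ xs) = trans (length-filter-∷ P? (f x) (map f xs))
  (trans (cong (𝟙 (does (P? (f x))) +_) (length-filter-map P? f xs)) (sym (length-filter-∷ (P? ∘ f) x xs)))

length-filter-allSubsets : ∀ {p} n {P : Pred (Subset n) p} (P? : Decidable P) →
                           length (filter P? (allSubsets n)) ≡ ∑ˢ n (λ S → 𝟙 (does (P? S)))
length-filter-allSubsets zero    P? = trans (length-filter-∷ P? [] _) (+-identityʳ _)
length-filter-allSubsets (suc n) P? = begin
  length (filter P? (map (true ∷_) Ss ++ map (false ∷_) Ss))
    ≡⟨ length-filter-++ P? (map (true ∷_) Ss) _ ⟩
  length (filter P? (map (true ∷_) Ss)) + length (filter P? (map (false ∷_) Ss))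
    ≡⟨ cong₂ _+_ (length-filter-map P? (true ∷_) Ss) (length-filter-map P? (false ∷_) Ss) ⟩
  length (filter (P? ∘ (true ∷_)) Ss) + length (filter (P? ∘ (false ∷_)) Ss)
    ≡⟨ cong₂ _+_ (length-filter-allSubsets n (P? ∘ (true ∷_))) (length-filter-allSubsets n (P? ∘ (false ∷_))) ⟩
  ∑ˢ (suc n) (λ S → 𝟙 (does (P? S))) ∎
  where
  open ≡-Reasoning
  Ss : List (Subset n)
  Ss = allSubsets n

∣∷∣ : ∀ {n} b (S : Subset n) → ∣ b ∷ S ∣ ≡ 𝟙 b + ∣ S ∣
∣∷∣ true  S = refl
∣∷∣ false S = refl

length-filter-tabulate : ∀ {a p} {A : Set a} {P : Pred A p} (P? : Decidable P) {n} (f : Fin n → A) →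
                         length (filter P? (List.tabulate f)) ≡ ∣ tabulate (does ∘ P? ∘ f) ∣
length-filter-tabulate P? {zero}  f = refl
length-filter-tabulate P? {suc n} f = begin
  length (filter P? (f zero ∷ List.tabulate (f ∘ suc)))
    ≡⟨ length-filter-∷ P? (f zero) _ ⟩
  𝟙 (does (P? (f zero))) + length (filter P? (List.tabulate (f ∘ suc)))
    ≡⟨ cong (𝟙 (does (P? (f zero))) +_) (length-filter-tabulate P? (f ∘ suc)) ⟩
  𝟙 (does (P? (f zero))) + ∣ tabulate (does ∘ P? ∘ f ∘ suc) ∣
    ≡⟨ ∣∷∣ (does (P? (f zero))) (tabulate (does ∘ P? ∘ f ∘ suc)) ⟨
  ∣ tabulate (does ∘ P? ∘ f) ∣ ∎
  where open ≡-Reasoning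

[_∉_] : ∀ {n} → Fin n → Subset n → ℕ
[ v ∉ T ] = 𝟙 (not (lookup T v))

∑-∉≡n∸∣∣ : ∀ {n} (T : Subset n) → ∑[ v < n ] [ v ∉ T ] ≡ n ∸ ∣ T ∣
∑-∉≡n∸∣∣ T = trans (sum-cong-≗ (λ v → cong 𝟙 (sym (lookup-map v not T))))
                   (trans (∑-𝟙-lookup (∁ T)) (∣∁p∣≡n∸∣p∣ T))

∣[]≔true∣ : ∀ {n} (T : Subset n) v → lookup T v ≡ false → ∣ T [ v ]≔ true ∣ ≡ suc ∣ T ∣
∣[]≔true∣ (false ∷ T) zero    _ = refl
∣[]≔true∣ (true  ∷ T) (suc v) v∉T = cong suc (∣[]≔true∣ T v v∉T)
∣[]≔true∣ (false ∷ T) (suc v) v∉T = ∣[]≔true∣ T v v∉T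

insertion-size : ∀ {n} (T : Subset n) v i x →
                 [ v ∉ T ] * (𝟙 (∣ T [ v ]≔ true ∣ ≡ᵇ suc i) * x) ≡ 𝟙 (∣ T ∣ ≡ᵇ i) * ([ v ∉ T ] * x)
insertion-size T v i x with lookup T v in v∉T
... | true  = sym (*-zeroʳ (𝟙 (∣ T ∣ ≡ᵇ i)))
... | false rewrite ∣[]≔true∣ T v v∉T =
  trans (+-identityʳ _) (cong (𝟙 (∣ T ∣ ≡ᵇ i) *_) (sym (+-identityʳ x)))

∑ˢ-∣∣*≡∑ˢ-∑-insert : ∀ n (g : Subset n → ℕ) →
  ∑ˢ n (λ S → ∣ S ∣ * g S) ≡ ∑ˢ n (λ T → ∑[ v < n ] ([ v ∉ T ] * g (T [ v ]≔ true)))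
∑ˢ-∣∣*≡∑ˢ-∑-insert zero    g = refl
∑ˢ-∣∣*≡∑ˢ-∑-insert (suc n) g = begin
  ∑ˢ n (λ S → g (true ∷ S) + ∣ S ∣ * g (true ∷ S)) + ∑ˢ n (λ S → ∣ S ∣ * g (false ∷ S))
    ≡⟨ cong (_+ ∑ˢ n (λ S → ∣ S ∣ * g (false ∷ S))) (∑ˢ-distrib-+ n _ _) ⟩
  (G + ∑ˢ n (λ S → ∣ S ∣ * g (true ∷ S))) + ∑ˢ n (λ S → ∣ S ∣ * g (false ∷ S))
    ≡⟨ cong₂ (λ x y → (G + x) + y) (∑ˢ-∣∣*≡∑ˢ-∑-insert n _) (∑ˢ-∣∣*≡∑ˢ-∑-insert n _) ⟩
  (G + A) + B
    ≡⟨ xy∙z≈y∙xz G A B ⟩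
  A + (G + B)
    ≡⟨ cong (A +_) (∑ˢ-distrib-+ n _ _) ⟨
  A + ∑ˢ n (λ T → g (true ∷ T) + B′ T)
    ≡⟨ cong (A +_) (∑ˢ-cong n (λ T → cong (_+ B′ T) (+-identityʳ (g (true ∷ T))))) ⟨
  ∑ˢ (suc n) (λ T → ∑[ v < suc n ] ([ v ∉ T ] * g (T [ v ]≔ true))) ∎
  where
  open ≡-Reasoning
  G A B : ℕ
  G = ∑ˢ n (λ S → g (true ∷ S))
  A = ∑ˢ n (λ T → ∑[ v < n ] ([ v ∉ T ] * g (true ∷ T [ v ]≔ true)))
  B′ : Subset n → ℕ
  B′ T = ∑[ v < n ] ([ v ∉ T ] * g (false ∷ T [ v ]≔ true))
  B = ∑ˢ n B′

∈-tabulate⁺ : ∀ {n p} {P : Pred (Fin n) p} (P? : Decidable P) {v} → P v → v ∈ tabulate (does ∘ P?)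
∈-tabulate⁺ P? {v} pv = lookup⇒[]= v _ (trans (lookup∘tabulate (does ∘ P?) v) (dec-true (P? v) pv))

∈-tabulate⁻ : ∀ {n p} {P : Pred (Fin n) p} (P? : Decidable P) {v} → v ∈ tabulate (does ∘ P?) → P v
∈-tabulate⁻ P? {v} v∈ = does≡true⇒ (P? v) (trans (sym (lookup∘tabulate (does ∘ P?) v)) ([]=⇒lookup v∈))

⊆-[]≔true : ∀ {n} (T : Subset n) v → T ⊆ T [ v ]≔ true
⊆-[]≔true T v {u} u∈T with u Finₚ.≟ v
... | yes refl = []≔-updates T u
... | no  u≢v  = []≔-minimal T u v u≢v u∈T

∈-[]≔true⁻ : ∀ {n} (T : Subset n) v {u} → u ∈ T [ v ]≔ true → u ≡ v ⊎ u ∈ T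
∈-[]≔true⁻ T v {u} u∈ with u Finₚ.≟ v
... | yes u≡v = inj₁ u≡v
... | no  u≢v = inj₂ (lookup⇒[]= u T (trans (sym (lookup∘updateAt′ u v u≢v T)) ([]=⇒lookup u∈)))

disjoint : ∀ {n} → Subset n → Subset n → Bool
disjoint []      []      = true
disjoint (a ∷ T) (b ∷ U) = not (a ∧ b) ∧ disjoint T U

disjoint-intro : ∀ {n} (T U : Subset n) → (∀ {v} → v ∈ T → v ∈ U → ⊥) → disjoint T U ≡ true
disjoint-intro []          []          _     = refl
disjoint-intro (true  ∷ T) (true  ∷ U) T∩U=∅ = ⊥-elim (T∩U=∅ here here)
disjoint-intro (true  ∷ T) (false ∷ U) T∩U=∅ = disjoint-intro T U (λ p q → T∩U=∅ (there p) (there q))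
disjoint-intro (false ∷ T) (b     ∷ U) T∩U=∅ = disjoint-intro T U (λ p q → T∩U=∅ (there p) (there q))

-- Binomial coefficients

C-monoˡ-suc : ∀ m k → m C k ≤ suc m C k
C-monoˡ-suc m zero    = ≤-refl
C-monoˡ-suc m (suc k) = ≤-trans (m≤n+m (m C suc k) (m C k)) (≤-reflexive (nCk+nC[k+1]≡[n+1]C[k+1] m k))

C-monoˡ-≤ : ∀ {m m′} k → m ≤ m′ → m C k ≤ m′ C k
C-monoˡ-≤ {m′ = zero}  k z≤n = ≤-refl
C-monoˡ-≤ {m′ = suc m′} k m≤1+m′ with m≤n⇒m<n∨m≡n m≤1+m′
... | inj₁ (s≤s m≤m′) = ≤-trans (C-monoˡ-≤ k m≤m′) (C-monoˡ-suc m′ k)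
... | inj₂ refl       = ≤-refl

[1+m∸[1+k]]*mC[1+k]≡[m∸k]*mC[1+k] : ∀ m k → suc (m ∸ suc k) * (m C suc k) ≡ (m ∸ k) * (m C suc k)
[1+m∸[1+k]]*mC[1+k]≡[m∸k]*mC[1+k] m k with k <? m
... | yes k<m = cong (_* (m C suc k)) (sym (+-∸-assoc 1 k<m))
... | no  k≮m rewrite k>n⇒nCk≡0 (s≤s (≮⇒≥ k≮m)) = trans (*-zeroʳ (m ∸ suc k)) (sym (*-zeroʳ (m ∸ k)))

[1+k]*mC[1+k]≡[m∸k]*mCk : ∀ m k → suc k * (m C suc k) ≡ (m ∸ k) * (m C k)
[1+k]*mC[1+k]≡[m∸k]*mCk zero    k       = trans (*-zeroʳ (suc k)) (cong (_* (0 C k)) (sym (0∸n≡0 k)))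
[1+k]*mC[1+k]≡[m∸k]*mCk (suc m) zero    = trans (+-identityʳ _) (trans (nC1≡n (suc m)) (sym (*-identityʳ (suc m))))
[1+k]*mC[1+k]≡[m∸k]*mCk (suc m) (suc j) = begin
  suc (suc j) * (suc m C suc (suc j))
    ≡⟨ cong (suc (suc j) *_) (nCk+nC[k+1]≡[n+1]C[k+1] m (suc j)) ⟨
  suc (suc j) * (c + c₂)
    ≡⟨ *-distribˡ-+ (suc (suc j)) c c₂ ⟩
  (c + suc j * c) + suc (suc j) * c₂
    ≡⟨ cong₂ (λ x y → (c + x) + y) ([1+k]*mC[1+k]≡[m∸k]*mCk m j) ([1+k]*mC[1+k]≡[m∸k]*mCk m (suc j)) ⟩
  (c + (m ∸ j) * c₀) + (m ∸ suc j) * c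
    ≡⟨ xy∙z≈y∙xz c ((m ∸ j) * c₀) ((m ∸ suc j) * c) ⟩
  (m ∸ j) * c₀ + suc (m ∸ suc j) * c
    ≡⟨ cong ((m ∸ j) * c₀ +_) ([1+m∸[1+k]]*mC[1+k]≡[m∸k]*mC[1+k] m j) ⟩
  (m ∸ j) * c₀ + (m ∸ j) * c
    ≡⟨ *-distribˡ-+ (m ∸ j) c₀ c ⟨
  (m ∸ j) * (c₀ + c)
    ≡⟨ cong ((m ∸ j) *_) (nCk+nC[k+1]≡[n+1]C[k+1] m j) ⟩
  (m ∸ j) * (suc m C suc j) ∎
  where
  open ≡-Reasoning
  c₀ c c₂ : ℕ
  c₀ = m C j
  c  = m C suc j
  c₂ = m C suc (suc j)

Cdiff-≥ : ∀ {a b m} k → b ≤ m → m ≤ a → (a ∸ m) C k ≤ Cdiff a b k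
Cdiff-≥ {a} {b} k b≤m m≤a with a <? b
... | yes a<b = ⊥-elim (<⇒≱ a<b (≤-trans b≤m m≤a))
... | no  _   = C-monoˡ-≤ k (∸-monoʳ-≤ a b≤m)

∑ˢ-size-disjoint : ∀ n (U : Subset n) i →
                   ∑ˢ n (λ T → 𝟙 (∣ T ∣ ≡ᵇ i) * 𝟙 (disjoint T U)) ≡ (n ∸ ∣ U ∣) C i
∑ˢ-size-disjoint zero    []          zero    = refl
∑ˢ-size-disjoint zero    []          (suc i) = refl
∑ˢ-size-disjoint (suc n) (true  ∷ U) i       =
  cong₂ _+_ (∑ˢ-zero n (λ T → *-zeroʳ (𝟙 (suc ∣ T ∣ ≡ᵇ i)))) (∑ˢ-size-disjoint n U i)
∑ˢ-size-disjoint (suc n) (false ∷ U) zero    = cong₂ _+_ (∑ˢ-zero n (λ _ → refl)) (∑ˢ-size-disjoint n U zero)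
∑ˢ-size-disjoint (suc n) (false ∷ U) (suc i) = begin
  ∑ˢ n (λ T → 𝟙 (∣ T ∣ ≡ᵇ i) * 𝟙 (disjoint T U))
  + ∑ˢ n (λ T → 𝟙 (∣ T ∣ ≡ᵇ suc i) * 𝟙 (disjoint T U))
    ≡⟨ cong₂ _+_ (∑ˢ-size-disjoint n U i) (∑ˢ-size-disjoint n U (suc i)) ⟩
  (n ∸ ∣ U ∣) C i + (n ∸ ∣ U ∣) C suc i
    ≡⟨ nCk+nC[k+1]≡[n+1]C[k+1] (n ∸ ∣ U ∣) i ⟩
  suc (n ∸ ∣ U ∣) C suc i
    ≡⟨ cong (_C suc i) (+-∸-assoc 1 (∣p∣≤n U)) ⟨
  (suc n ∸ ∣ U ∣) C suc i ∎
  where open ≡-Reasoning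

∑ˢ-size-disjoint-linear : ∀ n i a c {m} (b : Fin m → ℕ) (U : Subset n) (V : Fin m → Subset n) →
  ∑ˢ n (λ T → 𝟙 (∣ T ∣ ≡ᵇ i) * (a * 𝟙 (disjoint T U) + c * ∑[ w < m ] (b w * 𝟙 (disjoint T (V w)))))
  ≡ a * ((n ∸ ∣ U ∣) C i) + c * ∑[ w < m ] (b w * ((n ∸ ∣ V w ∣) C i))
∑ˢ-size-disjoint-linear n i a c {m} b U V = begin
  ∑ˢ n (λ T → s T * (a * 𝟙 (disjoint T U) + c * ∑[ w < m ] (b w * 𝟙 (disjoint T (V w)))))
    ≡⟨ ∑ˢ-cong n distribute ⟩
  ∑ˢ n (λ T → a * avoids T U + c * ∑[ w < m ] (b w * avoids T (V w)))
    ≡⟨ ∑ˢ-distrib-+ n _ _ ⟩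
  ∑ˢ n (λ T → a * avoids T U) + ∑ˢ n (λ T → c * ∑[ w < m ] (b w * avoids T (V w)))
    ≡⟨ cong₂ _+_ (*-distribˡ-∑ˢ n a _) (*-distribˡ-∑ˢ n c _) ⟨
  a * count U + c * ∑ˢ n (λ T → ∑[ w < m ] (b w * avoids T (V w)))
    ≡⟨ cong (λ x → a * count U + c * x) (∑ˢ-∑-comm n m (λ T w → b w * avoids T (V w))) ⟩
  a * count U + c * ∑[ w < m ] ∑ˢ n (λ T → b w * avoids T (V w))
    ≡⟨ cong (λ x → a * count U + c * x) (sum-cong-≗ (λ w → *-distribˡ-∑ˢ n (b w) _)) ⟨
  a * count U + c * ∑[ w < m ] (b w * count (V w))
    ≡⟨ cong₂ (λ x y → a * x + c * y) (∑ˢ-size-disjoint n U i)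
             (sum-cong-≗ (λ w → cong (b w *_) (∑ˢ-size-disjoint n (V w) i))) ⟩
  a * ((n ∸ ∣ U ∣) C i) + c * ∑[ w < m ] (b w * ((n ∸ ∣ V w ∣) C i)) ∎
  where
  open ≡-Reasoning
  s : Subset n → ℕ
  s T = 𝟙 (∣ T ∣ ≡ᵇ i)
  avoids : Subset n → Subset n → ℕ
  avoids T W = s T * 𝟙 (disjoint T W)
  count : Subset n → ℕ
  count W = ∑ˢ n (λ T → avoids T W)
  distribute : ∀ T → s T * (a * 𝟙 (disjoint T U) + c * ∑[ w < m ] (b w * 𝟙 (disjoint T (V w))))
                   ≡ a * avoids T U + c * ∑[ w < m ] (b w * avoids T (V w))
  distribute T = trans (*-distribˡ-+ (s T) _ _) (cong₂ _+_
    (*-Props.x∙yz≈y∙xz (s T) a _)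
    (trans (*-Props.x∙yz≈y∙xz (s T) c _) (cong (c *_)
      (trans (*-distribˡ-sum (s T) (λ w → b w * 𝟙 (disjoint T (V w))))
             (sum-cong-≗ (λ w → *-Props.x∙yz≈y∙xz (s T) (b w) _))))))

-- Dominating sets

d≡∑ˢ : ∀ {n} (G : Graph n) i → d G i ≡ ∑ˢ n (λ S → 𝟙 (∣ S ∣ ≡ᵇ i) * 𝟙 (does (dominating? G S)))
d≡∑ˢ {n} G i = trans (length-filter-allSubsets n _) (∑ˢ-cong n (λ S → 𝟙-∧ (∣ S ∣ ≡ᵇ i) _))

d[1+n]≡0 : ∀ {n} (G : Graph n) → d G (suc n) ≡ 0
d[1+n]≡0 {n} G = trans (d≡∑ˢ G (suc n))
  (∑ˢ-zero n (λ S → cong (λ b → 𝟙 b * 𝟙 (does (dominating? G S)))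
                         (dec-false (∣ S ∣ ≟ suc n) (<⇒≢ (s≤s (∣p∣≤n S))))))

module _ {n} (G : Graph n) where

  DominatedBy : Subset n → Fin n → Set
  DominatedBy S w = w ∈ S ⊎ ∃ λ u → u ∈ S × Adj G u w

  ¬dominating⇒undominated : ∀ {S} → ¬ Dominating G S → ∃ λ w → ¬ DominatedBy S w
  ¬dominating⇒undominated {S} = Finₚ.¬∀⟶∃¬ n (DominatedBy S) dominatedBy?
    where
    dominatedBy? : Decidable (DominatedBy S)
    dominatedBy? w = (w ∈? S) ⊎-dec Finₚ.any? (λ u → (u ∈? S) ×-dec (adj G u w Boolₚ.≟ true))

  dominating-⊆ : ∀ {S S′} → S ⊆ S′ → Dominating G S → Dominating G S′
  dominating-⊆ S⊆S′ dom w with dom w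
  ... | inj₁ w∈S             = inj₁ (S⊆S′ w∈S)
  ... | inj₂ (u , u∈S , uw) = inj₂ (u , S⊆S′ u∈S , uw)

  universal-dominates : ∀ {S v} → Universal G v → v ∈ S → Dominating G S
  universal-dominates {v = v} univ v∈S w with w Finₚ.≟ v
  ... | yes refl = inj₁ v∈S
  ... | no  w≢v  = inj₂ (v , v∈S , univ w w≢v)

  adjacent-or-equal? : ∀ w → Decidable (λ v → v ≡ w ⊎ Adj G v w)
  adjacent-or-equal? w v = (v Finₚ.≟ w) ⊎-dec (adj G v w Boolₚ.≟ true)

  N[_] : Fin n → Subset n
  N[ w ] = tabulate (does ∘ adjacent-or-equal? w)

  universals : Subset n
  universals = tabulate (does ∘ universal? G)

  ∣universals∣≡numUniversal : ∣ universals ∣ ≡ numUniversal G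
  ∣universals∣≡numUniversal = sym (length-filter-tabulate (universal? G) (λ v → v))

  undominated⇒disjoint-N : ∀ {T w} → ¬ DominatedBy T w → disjoint T N[ w ] ≡ true
  undominated⇒disjoint-N {T} {w} ¬dom =
    disjoint-intro T _ λ {v} v∈T v∈N → case ∈-tabulate⁻ (adjacent-or-equal? w) v∈N of λ where
      (inj₁ refl) → ¬dom (inj₁ v∈T)
      (inj₂ vw)   → ¬dom (inj₂ (v , v∈T , vw))

  ¬dominating⇒disjoint-universals : ∀ {T} → ¬ Dominating G T → disjoint T universals ≡ true
  ¬dominating⇒disjoint-universals {T} ¬dom =
    disjoint-intro T universals λ v∈T v∈U → ¬dom (universal-dominates (∈-tabulate⁻ (universal? G) v∈U) v∈T)

  dominating-insertion⇒∈N : ∀ {T w v} → ¬ DominatedBy T w → Dominating G (T [ v ]≔ true) → v ∈ N[ w ]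
  dominating-insertion⇒∈N {T} {w} {v} ¬dom dom with dom w
  ... | inj₁ w∈T+v with ∈-[]≔true⁻ T v w∈T+v
  ...   | inj₁ refl = ∈-tabulate⁺ (adjacent-or-equal? w) (inj₁ refl)
  ...   | inj₂ w∈T  = ⊥-elim (¬dom (inj₁ w∈T))
  dominating-insertion⇒∈N {T} {w} {v} ¬dom dom | inj₂ (u , u∈T+v , uw) with ∈-[]≔true⁻ T v u∈T+v
  ...   | inj₁ refl = ∈-tabulate⁺ (adjacent-or-equal? w) (inj₂ uw)
  ...   | inj₂ u∈T  = ⊥-elim (¬dom (inj₂ (u , u∈T , uw)))

  extension : Subset n → Fin n → ℕ
  extension T v = [ v ∉ T ] * 𝟙 (does (dominating? G (T [ v ]≔ true)))

  extensions : Subset n → ℕ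
  extensions T = ∑[ v < n ] extension T v

  extensions-of-dominating : ∀ {T} → Dominating G T → extensions T ≡ n ∸ ∣ T ∣
  extensions-of-dominating {T} dom = trans (sum-cong-≗ stays-dominating) (∑-∉≡n∸∣∣ T)
    where
    stays-dominating : ∀ v → extension T v ≡ [ v ∉ T ]
    stays-dominating v = trans
      (cong (λ b → [ v ∉ T ] * 𝟙 b) (dec-true (dominating? G _) (dominating-⊆ (⊆-[]≔true T v) dom)))
      (*-identityʳ [ v ∉ T ])

  extensions-≤-n : ∀ T → extensions T ≤ n
  extensions-≤-n T = ≤-trans (∑-≤-* _ at-most-one) (≤-reflexive (*-identityʳ n))
    where
    at-most-one : ∀ v → extension T v ≤ 1
    at-most-one v = *-mono-≤ (𝟙-≤-1 (not (lookup T v))) (𝟙-≤-1 _)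

  extensions-≤-∣N∣ : ∀ {T w} → ¬ DominatedBy T w → extensions T ≤ ∣ N[ w ] ∣
  extensions-≤-∣N∣ {T} {w} ¬dom =
    ≤-trans (∑-mono-≤ (λ v → only-N v (dominating? G _))) (≤-reflexive (∑-𝟙-lookup N[ w ]))
    where
    only-N : ∀ v (dom? : Dec (Dominating G (T [ v ]≔ true))) →
             [ v ∉ T ] * 𝟙 (does dom?) ≤ 𝟙 (lookup N[ w ] v)
    only-N v (no  _)   = ≤-trans (≤-reflexive (*-zeroʳ [ v ∉ T ])) z≤n
    only-N v (yes dom) = ≤-trans (*-monoˡ-≤ 1 (𝟙-≤-1 (not (lookup T v))))
                                 (≤-reflexive (cong 𝟙 (sym ([]=⇒lookup (dominating-insertion⇒∈N ¬dom dom)))))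

  nonDominatingExtensions : ℕ → ℕ
  nonDominatingExtensions i =
    ∑ˢ n (λ T → 𝟙 (∣ T ∣ ≡ᵇ i) * (𝟙 (not (does (dominating? G T))) * extensions T))

  extension-recurrence : ∀ i → suc i * d G (suc i) ≡ (n ∸ i) * d G i + nonDominatingExtensions i
  extension-recurrence i = begin
    suc i * d G (suc i)
      ≡⟨ cong (suc i *_) (d≡∑ˢ G (suc i)) ⟩
    suc i * ∑ˢ n g
      ≡⟨ *-distribˡ-∑ˢ n (suc i) g ⟩
    ∑ˢ n (λ S → suc i * g S)
      ≡⟨ ∑ˢ-cong n (λ S → 𝟙-≡ᵇ-weight ∣ S ∣ (suc i) _) ⟩
    ∑ˢ n (λ S → ∣ S ∣ * g S)
      ≡⟨ ∑ˢ-∣∣*≡∑ˢ-∑-insert n g ⟩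
    ∑ˢ n (λ T → ∑[ v < n ] ([ v ∉ T ] * g (T [ v ]≔ true)))
      ≡⟨ ∑ˢ-cong n (λ T → trans (sum-cong-≗ (λ v → insertion-size T v i _))
                                (sym (*-distribˡ-sum (𝟙 (∣ T ∣ ≡ᵇ i)) (extension T)))) ⟩
    ∑ˢ n (λ T → 𝟙 (∣ T ∣ ≡ᵇ i) * extensions T)
      ≡⟨ ∑ˢ-cong n (λ T → split T (dominating? G T)) ⟩
    ∑ˢ n (λ T → (n ∸ i) * (𝟙 (∣ T ∣ ≡ᵇ i) * 𝟙 (does (dominating? G T)))
              + 𝟙 (∣ T ∣ ≡ᵇ i) * (𝟙 (not (does (dominating? G T))) * extensions T))
      ≡⟨ ∑ˢ-distrib-+ n _ _ ⟩
    ∑ˢ n (λ T → (n ∸ i) * (𝟙 (∣ T ∣ ≡ᵇ i) * 𝟙 (does (dominating? G T)))) + nonDominatingExtensions i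
      ≡⟨ cong (_+ nonDominatingExtensions i)
              (trans (cong ((n ∸ i) *_) (d≡∑ˢ G i)) (*-distribˡ-∑ˢ n (n ∸ i) _)) ⟨
    (n ∸ i) * d G i + nonDominatingExtensions i ∎
    where
    open ≡-Reasoning
    g : Subset n → ℕ
    g S = 𝟙 (∣ S ∣ ≡ᵇ suc i) * 𝟙 (does (dominating? G S))
    split : ∀ T (dom? : Dec (Dominating G T)) →
            𝟙 (∣ T ∣ ≡ᵇ i) * extensions T
            ≡ (n ∸ i) * (𝟙 (∣ T ∣ ≡ᵇ i) * 𝟙 (does dom?))
              + 𝟙 (∣ T ∣ ≡ᵇ i) * (𝟙 (not (does dom?)) * extensions T)
    split T (yes dom) = begin
      𝟙 (∣ T ∣ ≡ᵇ i) * extensions T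
        ≡⟨ cong (𝟙 (∣ T ∣ ≡ᵇ i) *_) (extensions-of-dominating dom) ⟩
      𝟙 (∣ T ∣ ≡ᵇ i) * (n ∸ ∣ T ∣)
        ≡⟨ 𝟙-≡ᵇ-subst ∣ T ∣ i (n ∸_) ⟩
      𝟙 (∣ T ∣ ≡ᵇ i) * (n ∸ i)
        ≡⟨ *-comm (𝟙 (∣ T ∣ ≡ᵇ i)) (n ∸ i) ⟩
      (n ∸ i) * 𝟙 (∣ T ∣ ≡ᵇ i)
        ≡⟨ +-identityʳ _ ⟨
      (n ∸ i) * 𝟙 (∣ T ∣ ≡ᵇ i) + 0
        ≡⟨ cong₂ (λ a b → (n ∸ i) * a + b) (*-identityʳ (𝟙 (∣ T ∣ ≡ᵇ i)))
                                               (*-zeroʳ (𝟙 (∣ T ∣ ≡ᵇ i))) ⟨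
      (n ∸ i) * (𝟙 (∣ T ∣ ≡ᵇ i) * 1) + 𝟙 (∣ T ∣ ≡ᵇ i) * 0 ∎
    split T (no _) = sym (cong₂ _+_
      (trans (cong ((n ∸ i) *_) (*-zeroʳ (𝟙 (∣ T ∣ ≡ᵇ i)))) (*-zeroʳ (n ∸ i)))
      (cong (𝟙 (∣ T ∣ ≡ᵇ i) *_) (+-identityʳ (extensions T))))

  large : ℕ → Fin n → Bool
  large α w = does (α + 1 ≤? ∣ N[ w ] ∣)

  extensions-≤ : ∀ α {T} → ¬ Dominating G T →
    extensions T ≤ α * 𝟙 (disjoint T universals) + n * ∑[ w < n ] (𝟙 (large α w) * 𝟙 (disjoint T N[ w ]))
  extensions-≤ α {T} ¬dom with ¬dominating⇒undominated ¬dom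
  ... | w , ¬dom-w with α + 1 ≤? ∣ N[ w ] ∣
  ...   | yes α+1≤∣N∣ = begin
    extensions T                                                ≤⟨ extensions-≤-n T ⟩
    n                                                           ≡⟨ *-identityʳ n ⟨
    n * 1                                                       ≤⟨ *-monoʳ-≤ n w-counts ⟩
    n * ∑[ w < n ] (𝟙 (large α w) * 𝟙 (disjoint T N[ w ]))      ≤⟨ m≤n+m _ _ ⟩
    α * 𝟙 (disjoint T universals) + n * ∑[ w < n ] (𝟙 (large α w) * 𝟙 (disjoint T N[ w ])) ∎
    where
    open ≤-Reasoning
    w-counts : 1 ≤ ∑[ w < n ] (𝟙 (large α w) * 𝟙 (disjoint T N[ w ]))
    w-counts = ≤-trans
      (≤-reflexive (sym (cong₂ (λ a b → 𝟙 a * 𝟙 b) (dec-true (α + 1 ≤? ∣ N[ w ] ∣) α+1≤∣N∣)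
                                                   (undominated⇒disjoint-N ¬dom-w))))
      (≤-∑ (λ w → 𝟙 (large α w) * 𝟙 (disjoint T N[ w ])) w)
  ...   | no  α+1≰∣N∣ = ≤-trans (extensions-≤-∣N∣ ¬dom-w) (≤-trans ∣N∣≤α (m≤m+n _ _))
    where
    ∣N∣≤α : ∣ N[ w ] ∣ ≤ α * 𝟙 (disjoint T universals)
    ∣N∣≤α rewrite ¬dominating⇒disjoint-universals ¬dom | *-identityʳ α =
      ≤-pred (≤-trans (≰⇒> α+1≰∣N∣) (≤-reflexive (+-comm α 1)))

  nonDominatingExtensions-≤ : ∀ α i →
    nonDominatingExtensions i ≤ (n * n) * Cdiff n (α + 1) i + α * ((n ∸ numUniversal G) C i)
  nonDominatingExtensions-≤ α i = begin
    nonDominatingExtensions i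
      ≤⟨ ∑ˢ-mono-≤ n (λ T → *-monoʳ-≤ (𝟙 (∣ T ∣ ≡ᵇ i)) (bound T (dominating? G T))) ⟩
    ∑ˢ n (λ T → 𝟙 (∣ T ∣ ≡ᵇ i) * (α * 𝟙 (disjoint T universals)
                                  + n * ∑[ w < n ] (𝟙 (large α w) * 𝟙 (disjoint T N[ w ]))))
      ≡⟨ ∑ˢ-size-disjoint-linear n i α n (𝟙 ∘ large α) universals N[_] ⟩
    α * ((n ∸ ∣ universals ∣) C i) + n * ∑[ w < n ] (𝟙 (large α w) * ((n ∸ ∣ N[ w ] ∣) C i))
      ≤⟨ +-mono-≤ (≤-reflexive (cong (λ u → α * ((n ∸ u) C i)) ∣universals∣≡numUniversal))
                  (*-monoʳ-≤ n (∑-≤-* _ (λ w → large-term w (α + 1 ≤? ∣ N[ w ] ∣)))) ⟩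
    α * ((n ∸ numUniversal G) C i) + n * (n * Cdiff n (α + 1) i)
      ≡⟨ trans (+-comm (α * ((n ∸ numUniversal G) C i)) _)
               (cong (_+ α * ((n ∸ numUniversal G) C i)) (sym (*-assoc n n _))) ⟩
    (n * n) * Cdiff n (α + 1) i + α * ((n ∸ numUniversal G) C i) ∎
    where
    open ≤-Reasoning
    bound : ∀ T (dom? : Dec (Dominating G T)) → 𝟙 (not (does dom?)) * extensions T
            ≤ α * 𝟙 (disjoint T universals) + n * ∑[ w < n ] (𝟙 (large α w) * 𝟙 (disjoint T N[ w ]))
    bound T (yes _)  = z≤n
    bound T (no ¬dom) = ≤-trans (≤-reflexive (+-identityʳ (extensions T))) (extensions-≤ α ¬dom)
    large-term : ∀ w (big? : Dec (α + 1 ≤ ∣ N[ w ] ∣)) →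
                 𝟙 (does big?) * ((n ∸ ∣ N[ w ] ∣) C i) ≤ Cdiff n (α + 1) i
    large-term w (yes big) = ≤-trans (≤-reflexive (+-identityʳ _)) (Cdiff-≥ i big (∣p∣≤n N[ w ]))
    large-term w (no _)    = z≤n

-- Sequences obeying the recurrence

-- i ↦ X i / D i is nonincreasing on [k, ∞), with the division cleared.
RelativelyDecreasing : (ℕ → ℕ) → (ℕ → ℕ) → ℕ → Set
RelativelyDecreasing X D k = ∀ {i} → k ≤ i → X i * D k ≤ X k * D i

module _ {D : ℕ → ℕ} {k : ℕ} where

  relDec-+ : ∀ {X Y} → RelativelyDecreasing X D k → RelativelyDecreasing Y D k →
             RelativelyDecreasing (λ i → X i + Y i) D k
  relDec-+ {X} {Y} X↓ Y↓ {i} k≤i = begin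
    (X i + Y i) * D k       ≡⟨ *-distribʳ-+ (D k) (X i) (Y i) ⟩
    X i * D k + Y i * D k   ≤⟨ +-mono-≤ (X↓ k≤i) (Y↓ k≤i) ⟩
    X k * D i + Y k * D i   ≡⟨ *-distribʳ-+ (D i) (X k) (Y k) ⟨
    (X k + Y k) * D i       ∎
    where open ≤-Reasoning

  relDec-* : ∀ c {X} → RelativelyDecreasing X D k → RelativelyDecreasing (λ i → c * X i) D k
  relDec-* c {X} X↓ {i} k≤i = begin
    c * X i * D k     ≡⟨ *-assoc c (X i) (D k) ⟩
    c * (X i * D k)   ≤⟨ *-monoʳ-≤ c (X↓ k≤i) ⟩
    c * (X k * D i)   ≡⟨ *-assoc c (X k) (D i) ⟨
    c * X k * D i     ∎
    where open ≤-Reasoning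

positive-factorʳ : ∀ a {b} → 0 < a * b → 0 < b
positive-factorʳ a {zero}  a*0>0 rewrite *-zeroʳ a = a*0>0
positive-factorʳ a {suc b} _ = s≤s z≤n

module _ {n} {D : ℕ → ℕ} (growth : ∀ i → (n ∸ i) * D i ≤ suc i * D (suc i)) where

  relDec-C : ∀ {m k} → m ≤ n → RelativelyDecreasing (m C_) D k
  relDec-C         m≤n {zero}  z≤n = ≤-refl
  relDec-C {m} {k} m≤n {suc i} k≤1+i with m≤n⇒m<n∨m≡n k≤1+i
  ... | inj₂ refl      = ≤-refl
  ... | inj₁ (s≤s k≤i) = *-cancelˡ-≤ (suc i) (begin
    suc i * ((m C suc i) * D k)     ≡⟨ *-assoc (suc i) (m C suc i) (D k) ⟨
    suc i * (m C suc i) * D k       ≡⟨ cong (_* D k) ([1+k]*mC[1+k]≡[m∸k]*mCk m i) ⟩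
    (m ∸ i) * (m C i) * D k         ≡⟨ *-assoc (m ∸ i) (m C i) (D k) ⟩
    (m ∸ i) * ((m C i) * D k)       ≤⟨ *-monoʳ-≤ (m ∸ i) (relDec-C m≤n k≤i) ⟩
    (m ∸ i) * ((m C k) * D i)       ≤⟨ *-monoˡ-≤ ((m C k) * D i) (∸-monoˡ-≤ i m≤n) ⟩
    (n ∸ i) * ((m C k) * D i)       ≡⟨ *-Props.x∙yz≈y∙xz (n ∸ i) (m C k) (D i) ⟩
    (m C k) * ((n ∸ i) * D i)       ≤⟨ *-monoʳ-≤ (m C k) (growth i) ⟩
    (m C k) * (suc i * D (suc i))   ≡⟨ *-Props.x∙yz≈y∙xz (m C k) (suc i) (D (suc i)) ⟩
    suc i * ((m C k) * D (suc i))   ∎)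
    where open ≤-Reasoning

  relDec-Cdiff : ∀ b {k} → RelativelyDecreasing (λ i → Cdiff n b i) D k
  relDec-Cdiff b k≤i with n <? b
  ... | yes _ = z≤n
  ... | no  _ = relDec-C (m∸n≤m n b) k≤i

  positive-upto : ∀ {k i} → 0 < D k → k ≤ i → i ≤ n → 0 < D i
  positive-upto {i = zero}  Dk>0 z≤n   _     = Dk>0
  positive-upto {k} {suc i} Dk>0 k≤1+i 1+i≤n with m≤n⇒m<n∨m≡n k≤1+i
  ... | inj₂ refl      = Dk>0
  ... | inj₁ (s≤s k≤i) = positive-factorʳ (suc i)
    (<-≤-trans (*-mono-< (m<n⇒0<n∸m 1+i≤n) (positive-upto Dk>0 k≤i (<⇒≤ 1+i≤n))) (growth i))

[n∸i]+[2i+1∸n]≡1+i : ∀ {n i} → i ≤ n → n ≤ 2 * i → (n ∸ i) + (2 * i + 1 ∸ n) ≡ suc i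
[n∸i]+[2i+1∸n]≡1+i {n} {i} i≤n n≤2i = begin
  (n ∸ i) + (2 * i + 1 ∸ n)   ≡⟨ +-∸-assoc (n ∸ i) (≤-trans n≤2i (m≤m+n (2 * i) 1)) ⟨
  (n ∸ i) + (2 * i + 1) ∸ n   ≡⟨ cong (λ x → (n ∸ i) + x ∸ n) (2i+1≡i+[1+i] i) ⟩
  (n ∸ i) + (i + suc i) ∸ n   ≡⟨ cong (_∸ n) (+-assoc (n ∸ i) i (suc i)) ⟨
  (n ∸ i) + i + suc i ∸ n     ≡⟨ cong (λ x → x + suc i ∸ n) (m∸n+n≡m i≤n) ⟩
  n + suc i ∸ n               ≡⟨ m+n∸m≡n n (suc i) ⟩
  suc i                       ∎
  where
  open ≡-Reasoning
  2i+1≡i+[1+i] : ∀ i → 2 * i + 1 ≡ i + suc i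
  2i+1≡i+[1+i] = solve-∀

module _ {n} {D N : ℕ → ℕ} (recurrence : ∀ i → suc i * D (suc i) ≡ (n ∸ i) * D i + N i) where

  growth : ∀ i → (n ∸ i) * D i ≤ suc i * D (suc i)
  growth i = ≤-trans (m≤m+n ((n ∸ i) * D i) (N i)) (≤-reflexive (sym (recurrence i)))

  strictly-decreasing-from : ∀ {k} X → n ≤ 2 * k → (∀ i → N i ≤ X i) → RelativelyDecreasing X D k →
                             X k < (2 * k + 1 ∸ n) * D k → ∀ i → k ≤ i → i < n → D (suc i) < D i
  strictly-decreasing-from {k} X n≤2k N≤X X↓ Xk<cDk i k≤i i<n = *-cancelˡ-< (suc i) (D (suc i)) (D i) (begin-strict
    suc i * D (suc i)                       ≡⟨ recurrence i ⟩
    (n ∸ i) * D i + N i                     <⟨ +-monoʳ-< ((n ∸ i) * D i) N<cᵢDᵢ ⟩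
    (n ∸ i) * D i + (2 * i + 1 ∸ n) * D i   ≡⟨ *-distribʳ-+ (D i) (n ∸ i) (2 * i + 1 ∸ n) ⟨
    ((n ∸ i) + (2 * i + 1 ∸ n)) * D i       ≡⟨ cong (_* D i) ([n∸i]+[2i+1∸n]≡1+i (<⇒≤ i<n) n≤2i) ⟩
    suc i * D i                             ∎)
    where
    open ≤-Reasoning
    c : ℕ
    c = 2 * k + 1 ∸ n
    n≤2i : n ≤ 2 * i
    n≤2i = ≤-trans n≤2k (*-monoʳ-≤ 2 k≤i)
    Dᵢ>0 : 0 < D i
    Dᵢ>0 = positive-upto growth (positive-factorʳ c (≤-<-trans z≤n Xk<cDk)) k≤i (<⇒≤ i<n)
    N<cDᵢ : N i < c * D i
    N<cDᵢ = *-cancelʳ-< (D k) (N i) (c * D i) (begin-strict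
      N i * D k         ≤⟨ *-monoˡ-≤ (D k) (N≤X i) ⟩
      X i * D k         ≤⟨ X↓ k≤i ⟩
      X k * D i         <⟨ *-monoˡ-< (D i) {{>-nonZero Dᵢ>0}} Xk<cDk ⟩
      c * D k * D i     ≡⟨ *-Props.xy∙z≈xz∙y c (D k) (D i) ⟩
      c * D i * D k     ∎)
    N<cᵢDᵢ : N i < (2 * i + 1 ∸ n) * D i
    N<cᵢDᵢ = <-≤-trans N<cDᵢ (*-monoˡ-≤ (D i) (∸-monoˡ-≤ n (+-monoˡ-≤ 1 (*-monoʳ-≤ 2 k≤i))))

mode-≤ : ∀ {D : ℕ → ℕ} {n k} → k ≤ n → 0 < D k → D (suc n) ≡ 0 →
         (∀ i → k ≤ i → i < n → D (suc i) < D i) →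
         ∀ m → (∀ i → i < m → D i ≤ D (suc i)) → m ≤ k
mode-≤ {D} {k = k} k≤n Dk>0 D[1+n]≡0 decreasing m increasing with m ≤? k
... | yes m≤k = m≤k
... | no  m≰k with m≤n⇒m<n∨m≡n k≤n
...   | inj₁ k<n  = ⊥-elim (<⇒≱ (decreasing k ≤-refl k<n) (increasing k (≰⇒> m≰k)))
...   | inj₂ refl = ⊥-elim (<⇒≱ Dk>0 (≤-trans (increasing k (≰⇒> m≰k)) (≤-reflexive D[1+n]≡0)))

theorem1p4 : ∀ {n} (G : Graph n) (h k : ℕ) → h ≡ numUniversal G
    → n ≤ 2 * k → k ≤ n
    → (∃ λ α → 1 ≤ α × (n * n) * Cdiff n (α + 1) k + α * ((n ∸ h) C k) < (2 * k + 1 ∸ n) * d G k)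
    → (∀ i → k ≤ i → i < n → d G (suc i) < d G i)
    × (∀ m → (∀ i → i < m → d G i ≤ d G (suc i)) → (∀ i → m ≤ i → d G (suc i) ≤ d G i) → m ≤ k)
theorem1p4 {n} G h k refl n≤2k k≤n (α , _ , Xk<cdk) = decreasing , λ m increasing _ → mode≤k m increasing
  where
  X : ℕ → ℕ
  X i = (n * n) * Cdiff n (α + 1) i + α * ((n ∸ h) C i)
  recurrence : ∀ i → suc i * d G (suc i) ≡ (n ∸ i) * d G i + nonDominatingExtensions G i
  recurrence = extension-recurrence G
  X↓ : RelativelyDecreasing X (d G) k
  X↓ = relDec-+ {X = λ i → (n * n) * Cdiff n (α + 1) i} {Y = λ i → α * ((n ∸ h) C i)}
                (relDec-* (n * n) (relDec-Cdiff (growth recurrence) (α + 1)))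
                (relDec-* α {X = (n ∸ h) C_} (relDec-C (growth recurrence) (m∸n≤m n h)))
  decreasing : ∀ i → k ≤ i → i < n → d G (suc i) < d G i
  decreasing = strictly-decreasing-from recurrence X n≤2k (nonDominatingExtensions-≤ G α) X↓ Xk<cdk
  mode≤k : ∀ m → (∀ i → i < m → d G i ≤ d G (suc i)) → m ≤ k
  mode≤k = mode-≤ k≤n (positive-factorʳ (2 * k + 1 ∸ n) (≤-<-trans z≤n Xk<cdk)) (d[1+n]≡0 G) decreasing
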